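{- Let $(A_n,\varphi_n^m)$ be a projective sequence of finite $\mathcal L_R$-structures with projective limit $\mathbb A$, and assume $R^{A_n}$ is reflexive and symmetric for every $n$. The sequence is fine if and only if for all $n\in\mathbb N$ and $a,b\in A_n$ with $d_{R^{A_n}}(a,b)=2$ there is $m>n$ such that for all $a'\in(\varphi_n^m)^{ -1}(a)$ and $b'\in(\varphi_n^m)^{ -1}(b)$ one has $d_{R^{A_m}}(a',b')\ge3$.
   Context: $\mathcal L_R$ is a relational language containing a distinguished binary relation symbol $R$. Finite $\mathcal L_R$-structures carry the discrete topology. An epimorphism $\varphi:A\to B$ is a continuous surjection with $r^B=(\varphi\times\cdots\times\varphi)[r^A]$ for each relation symbol $r$. A projective sequence $(A_n,\varphi_n^m)$ consists of structures $A_n$, epimorphisms $\varphi_n^{n+1}:A_{n+1}\to A_n$, $\varphi_n^m=\varphi_n^{n+1}\cdots\varphi_{m-1}^m$, $\varphi_n^n=\mathrm{id}$; its projective limit is $\mathbb A=\{u\in\prod_nA_n:u(n)=\varphi_n^{n+1}(u(n+1))\}$ with product topology and $r^{\mathbb A}(u_1,\dots,u_j)$ iff $r^{A_n}(u_1(n),\dots,u_j(n))$ for all $n$. The sequence is fine if $R^{\mathbb A}$ is an equivalence relation. For a reflexive symmetric relation $S$, $d_S$ is the graph distance ($\infty$ between different connected components of the graph). -}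

module Defs where

open import Data.Nat using (ℕ; zero; suc; _≤_; _<_; _≤′_; ≤′-reflexive; ≤′-step)
open import Data.Nat.Properties using (≤⇒≤′)
open import Data.Fin using (Fin)
open import Data.Product using (Σ; ∃; ∃-syntax; _×_; _,_)
open import Function using (id; _∘_)
open import Relation.Binary.PropositionalEquality using (_≡_; refl)
open import Relation.Binary.Structures using (IsEquivalence)

_⟺_ : Set → Set → Set
P ⟺ Q = (P → Q) × (Q → P)

infix 2 _⟺_

-- A relational language L_R: the distinguished binary symbol R together with
-- an arbitrary family of further relation symbols, each with an arity.
record Language : Set₁ where
  field
    Sym   : Set
    arity : Sym → ℕ

-- A finite L_R-structure: universe Fin size (finite, discrete topology),
-- the interpretation of R, and the interpretation of every other symbol
-- (as a set of tuples).
record Structure (L : Language) : Set₁ where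
  open Language L
  field
    size : ℕ
    R    : Fin size → Fin size → Set
    rel  : (s : Sym) → (Fin (arity s) → Fin size) → Set

  Carrier : Set
  Carrier = Fin size

open Structure public

-- Epimorphism A → B: a surjection with r^B = (φ × … × φ)[r^A] for every
-- relation symbol r (including R).  Continuity is automatic for maps
-- between finite discrete spaces.
record Epi {L : Language} (A B : Structure L) : Set where
  open Language L
  field
    map       : Carrier A → Carrier B
    surj      : ∀ b → ∃[ a ] map a ≡ b
    R-image   : ∀ b₁ b₂ →
                R B b₁ b₂ ⟺ (∃[ a₁ ] ∃[ a₂ ] (R A a₁ a₂ × map a₁ ≡ b₁ × map a₂ ≡ b₂))
    rel-image : ∀ s (b : Fin (arity s) → Carrier B) →
                rel B s b ⟺ (∃[ a ] (rel A s a × (∀ i → map (a i) ≡ b i)))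

open Epi public

-- A projective sequence (A_n, φ_n^m) of finite L_R-structures, given by the
-- bonding epimorphisms φ_n^{n+1} : A_{n+1} → A_n.
record ProjSeq (L : Language) : Set₁ where
  field
    A   : ℕ → Structure L
    φ   : ∀ n → Epi (A (suc n)) (A n)

open ProjSeq public

module _ {L : Language} (P : ProjSeq L) where

  φ′ : ∀ n m → n ≤′ m → Carrier (A P m) → Carrier (A P n)
  φ′ n .n (≤′-reflexive refl) = id
  φ′ n (suc m) (≤′-step p)    = φ′ n m p ∘ map (φ P m)

  φₙᵐ : ∀ n m → n ≤ m → Carrier (A P m) → Carrier (A P n)
  φₙᵐ n m p = φ′ n m (≤⇒≤′ p)

  -- points of the projective limit 𝔸: compatible threads
  Thread : Set
  Thread = Σ (∀ n → Carrier (A P n)) λ u → ∀ n → u n ≡ map (φ P n) (u (suc n))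

  R𝔸 : Thread → Thread → Set
  R𝔸 (u , _) (v , _) = ∀ n → R (A P n) (u n) (v n)

  Fine : Set
  Fine = IsEquivalence R𝔸

data Walk {X : Set} (S : X → X → Set) : X → X → ℕ → Set where
  nil  : ∀ {a} → Walk S a a zero
  cons : ∀ {a b c k} → S a b → Walk S b c k → Walk S a c (suc k)

-- Graph distance d_S(a,b) = least length of a walk from a to b (∞ if none).
-- d_S(a,b) = k :
DistEq : {X : Set} → (X → X → Set) → X → X → ℕ → Set
DistEq S a b k = Walk S a b k × (∀ j → Walk S a b j → k ≤ j)

-- k ≤ d_S(a,b) (this includes d_S(a,b) = ∞):
DistGe : {X : Set} → (X → X → Set) → X → X → ℕ → Set
DistGe S a b k = ∀ j → Walk S a b j → k ≤ j

Reflexive′ : {X : Set} → (X → X → Set) → Set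
Reflexive′ S = ∀ a → S a a

Symmetric′ : {X : Set} → (X → X → Set) → Set
Symmetric′ S = ∀ {a b} → S a b → S b a

module Submission where

-- If R^𝔸 fails to be transitive, some u, v, w in 𝔸 have R(u(n), v(n)), R(v(n), w(n)) but not
-- R(u(n), w(n)), so d(u(n), w(n)) = 2 while at every level m the points u(m), w(m) lying over
-- them are joined through v(m); the separation condition forbids this.  Conversely, if a, b
-- with d(a, b) = 2 have lifts at distance at most 2 at every level m > n, these lifts have a
-- common neighbour c_m.  By König's lemma (classically, through the infinite pigeonhole
-- principle on the finite levels) the c_m can be chosen to form a thread v, and then the lifts
-- can be chosen to form threads u over a and w over b with R^𝔸(u, v) and R^𝔸(v, w).
-- Fineness gives R^𝔸(u, w), hence R(a, b), contradicting d(a, b) = 2.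

open import Defs
open import Level using (0ℓ)
open import Axiom.ExcludedMiddle using (ExcludedMiddle)
open import Axiom.DoubleNegationElimination using (DoubleNegationElimination; em⇒dne)
open import Data.Nat using (ℕ; zero; suc; _<_; _≤_; _+_; _⊔_; s≤s; _≤′_; ≤′-reflexive; ≤′-step)
open import Data.Nat.Properties
  using (<⇒≤; ≤⇒≤′; ≤′⇒≤; z≤′n; ≤-refl; ≤-trans; ≤-irrelevant; <-irrefl; ≮⇒≥; 1+n≰n; m≤n⇒m≤1+n;
         m≤m+n; m≤n+m; m≤m⊔n; m≤n⊔m)
open import Data.Fin using (Fin)
open import Data.Product using (Σ; ∃; ∃-syntax; _×_; _,_; proj₁; proj₂; map₂)
open import Data.Empty using (⊥-elim)
open import Function using (_∘_)
open import Relation.Nullary using (¬_; yes; no)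
open import Relation.Binary.PropositionalEquality using (_≡_; refl; sym; trans; cong; subst; subst₂)
open import Relation.Binary.Structures using (IsEquivalence)

≤′-irrelevant : ∀ {m n} (p q : m ≤′ n) → p ≡ q
≤′-irrelevant (≤′-reflexive refl) (≤′-reflexive refl) = refl
≤′-irrelevant (≤′-reflexive refl) (≤′-step q)         = ⊥-elim (1+n≰n (≤′⇒≤ q))
≤′-irrelevant (≤′-step p)         (≤′-reflexive refl) = ⊥-elim (1+n≰n (≤′⇒≤ p))
≤′-irrelevant (≤′-step p)         (≤′-step q)         = cong ≤′-step (≤′-irrelevant p q)

infinitePigeonhole : ExcludedMiddle 0ℓ → ∀ {N} (Q : Fin N → ℕ → Set) →
                     (∀ x {i j} → i ≤ j → Q x j → Q x i) →
                     (∀ j → ∃ λ x → Q x j) → ∃ λ x → ∀ j → Q x j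
infinitePigeonhole em {zero} Q antitone often with often 0
... | () , _
infinitePigeonhole em {suc N} Q antitone often with em {∀ j → Q Fin.zero j}
... | yes always = Fin.zero , always
... | no ¬always =
  let x , always = infinitePigeonhole em (Q ∘ Fin.suc) (antitone ∘ Fin.suc) oftenInTail
  in Fin.suc x , always
  where
  dne : DoubleNegationElimination 0ℓ
  dne = em⇒dne em

  failure : ∃ λ j → ¬ Q Fin.zero j
  failure = dne λ ¬failure → ¬always λ j → dne λ ¬q → ¬failure (j , ¬q)

  oftenInTail : ∀ j → ∃ λ x → Q (Fin.suc x) j
  oftenInTail j with often (j ⊔ proj₁ failure)
  ... | Fin.zero  , q = ⊥-elim (proj₂ failure (antitone Fin.zero (m≤n⊔m j _) q))
  ... | Fin.suc x , q = x , antitone (Fin.suc x) (m≤m⊔n j _) q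

module König (em : ExcludedMiddle 0ℓ) {s : ℕ → ℕ} (f : ∀ k → Fin (s (suc k)) → Fin (s k))
  (S : ∀ k → Fin (s k) → Set) (S-closed : ∀ k y → S (suc k) y → S k (f k y))
  (S-cofinal : ∀ j → ∃ λ m → j ≤ m × Σ (Fin (s m)) (S m)) where

  data Above : ∀ k m → Fin (s k) → Fin (s m) → Set where
    here : ∀ {k x} → Above k k x x
    step : ∀ {k m x y} → Above k m x (f m y) → Above k (suc m) x y

  below : ∀ {k m} → k ≤′ m → (y : Fin (s m)) → ∃ λ x → Above k m x y
  below (≤′-reflexive refl) y = y , here
  below {m = suc m} (≤′-step k≤m) y = map₂ step (below k≤m (f m y))

  above-closed : ∀ {k m x y} → Above k m x y → S m y → S k x
  above-closed here Sy = Sy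
  above-closed {m = suc m} {y = y} (step a) Sy = above-closed a (S-closed m y Sy)

  splitLast : ∀ {k m x} y → Above k m x (f m y) → ∃ λ x′ → f k x′ ≡ x × Above (suc k) (suc m) x′ y
  splitLast y here = y , refl , here
  splitLast {m = suc m} y (step a) = map₂ (map₂ step) (splitLast (f (suc m) y) a)

  above-split : ∀ {k m x y} → k < m → Above k m x y → ∃ λ x′ → f k x′ ≡ x × Above (suc k) m x′ y
  above-split k<k here = ⊥-elim (<-irrefl refl k<k)
  above-split {y = y} _ (step a) = splitLast y a

  Reaches : ∀ k → Fin (s k) → ℕ → Set
  Reaches k x j = ∃ λ m → ∃ λ y → j ≤ m × S m y × Above k m x y

  Unbounded : ∀ k → Fin (s k) → Set
  Unbounded k x = ∀ j → Reaches k x j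

  reaches-antitone : ∀ {k x i j} → i ≤ j → Reaches k x j → Reaches k x i
  reaches-antitone i≤j (m , y , j≤m , Sy , a) = m , y , ≤-trans i≤j j≤m , Sy , a

  unbounded⇒S : ∀ {k x} → Unbounded k x → S k x
  unbounded⇒S u with u 0
  ... | _ , _ , _ , Sy , a = above-closed a Sy

  unbounded-root : ∃ (Unbounded 0)
  unbounded-root = infinitePigeonhole em (Reaches 0) (λ _ → reaches-antitone) reach
    where
    reach : ∀ j → ∃ λ x → Reaches 0 x j
    reach j with S-cofinal j
    ... | m , j≤m , y , Sy = map₂ (λ a → m , y , j≤m , Sy , a) (below z≤′n y)

  unbounded-child : ∀ {k x} → Unbounded k x → ∃ λ x′ → f k x′ ≡ x × Unbounded (suc k) x′
  unbounded-child {k} {x} u with infinitePigeonhole em Q (λ _ i≤j → map₂ (reaches-antitone i≤j)) reach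
    where
    Q : Fin (s (suc k)) → ℕ → Set
    Q x′ j = f k x′ ≡ x × Reaches (suc k) x′ j

    reach : ∀ j → ∃ λ x′ → Q x′ j
    reach j with u (j + suc k)
    ... | m , y , j+1+k≤m , Sy , a with above-split (≤-trans (m≤n+m (suc k) j) j+1+k≤m) a
    ... | x′ , fx′≡x , a′ = x′ , fx′≡x , m , y , ≤-trans (m≤m+n j (suc k)) j+1+k≤m , Sy , a′
  ... | x′ , always = x′ , proj₁ (always 0) , proj₂ ∘ always

  unboundedPath : ∀ k → ∃ (Unbounded k)
  unboundedPath zero    = unbounded-root
  unboundedPath (suc k) = map₂ proj₂ (unbounded-child (proj₂ (unboundedPath k)))

  könig : Σ (∀ k → Fin (s k)) λ t → (∀ k → t k ≡ f k (t (suc k))) × (∀ k → S k (t k))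
  könig = proj₁ ∘ unboundedPath
        , (λ k → sym (proj₁ (proj₂ (unbounded-child (proj₂ (unboundedPath k))))))
        , unbounded⇒S ∘ proj₂ ∘ unboundedPath

CommonNeighbour : {X : Set} → (X → X → Set) → X → X → Set
CommonNeighbour S a b = ∃ λ c → S a c × S c b

module _ {X : Set} {S : X → X → Set} (S-refl : Reflexive′ S) where

  short-walk⇒adjacent : ∀ {a b j} → j < 2 → Walk S a b j → S a b
  short-walk⇒adjacent {a} _ nil = S-refl a
  short-walk⇒adjacent _ (cons r nil) = r
  short-walk⇒adjacent (s≤s (s≤s ())) (cons _ (cons _ _))

  short-walk⇒commonNeighbour : ∀ {a b j} → j < 3 → Walk S a b j → CommonNeighbour S a b
  short-walk⇒commonNeighbour {a} _ nil = a , S-refl a , S-refl a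
  short-walk⇒commonNeighbour {b = b} _ (cons r nil) = b , r , S-refl b
  short-walk⇒commonNeighbour _ (cons r (cons r′ nil)) = _ , r , r′
  short-walk⇒commonNeighbour (s≤s (s≤s (s≤s ()))) (cons _ (cons _ (cons _ _)))

  ¬adjacent⇒DistGe2 : ∀ {a b} → ¬ S a b → DistGe S a b 2
  ¬adjacent⇒DistGe2 ¬Sab j w = ≮⇒≥ (λ j<2 → ¬Sab (short-walk⇒adjacent j<2 w))

  ¬commonNeighbour⇒DistGe3 : ∀ {a b} → ¬ CommonNeighbour S a b → DistGe S a b 3
  ¬commonNeighbour⇒DistGe3 ¬cn j w = ≮⇒≥ (λ j<3 → ¬cn (short-walk⇒commonNeighbour j<3 w))

module _ {L : Language} (P : ProjSeq L) where

  bond : ∀ k → Carrier (A P (suc k)) → Carrier (A P k)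
  bond k = map (φ P k)

  R-bond : ∀ k {x y} → R (A P (suc k)) x y → R (A P k) (bond k x) (bond k y)
  R-bond k {x} {y} r = proj₂ (R-image (φ P k) (bond k x) (bond k y)) (x , y , r , refl , refl)

  φ′-irrelevant : ∀ {n m} (p q : n ≤′ m) x → φ′ P n m p x ≡ φ′ P n m q x
  φ′-irrelevant p q x = cong (λ r → φ′ P _ _ r x) (≤′-irrelevant p q)

  φₙᵐ-irrelevant : ∀ {n m} (p q : n ≤ m) x → φₙᵐ P n m p x ≡ φₙᵐ P n m q x
  φₙᵐ-irrelevant p q x = cong (λ r → φₙᵐ P _ _ r x) (≤-irrelevant p q)

  φₙᵐ-refl : ∀ {n} (p : n ≤ n) x → φₙᵐ P n n p x ≡ x
  φₙᵐ-refl p = φ′-irrelevant (≤⇒≤′ p) (≤′-reflexive refl)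

  φₙᵐ-step : ∀ {n k} (p : n ≤ suc k) (q : n ≤ k) y → φₙᵐ P n (suc k) p y ≡ φₙᵐ P n k q (bond k y)
  φₙᵐ-step p q = φ′-irrelevant (≤⇒≤′ p) (≤′-step (≤⇒≤′ q))

  φ′-thread : (u : Thread P) → ∀ {n m} (p : n ≤′ m) → φ′ P n m p (proj₁ u m) ≡ proj₁ u n
  φ′-thread u (≤′-reflexive refl) = refl
  φ′-thread u {m = suc m} (≤′-step p) = trans (cong (φ′ P _ m p) (sym (proj₂ u m))) (φ′-thread u p)

  φₙᵐ-thread : (u : Thread P) → ∀ {n m} (p : n ≤ m) → φₙᵐ P n m p (proj₁ u m) ≡ proj₁ u n
  φₙᵐ-thread u p = φ′-thread u (≤⇒≤′ p)

  -- Quantifying over all proofs of n ≤ k makes the notion vacuous below level n.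
  LiesOver : ∀ {n} → Carrier (A P n) → ∀ k → Carrier (A P k) → Set
  LiesOver {n} a k x = ∀ p → φₙᵐ P n k p x ≡ a

  liesOver-intro : ∀ {n k a x} (p : n ≤ k) → φₙᵐ P n k p x ≡ a → LiesOver a k x
  liesOver-intro {x = x} p φx≡a q = trans (φₙᵐ-irrelevant q p x) φx≡a

  liesOver-bond : ∀ {n k} {a : Carrier (A P n)} {y} → LiesOver a (suc k) y → LiesOver a k (bond k y)
  liesOver-bond {y = y} over q = trans (sym (φₙᵐ-step (m≤n⇒m≤1+n q) q y)) (over (m≤n⇒m≤1+n q))

  liesOver-self : ∀ {n} {a x : Carrier (A P n)} → LiesOver a n x → x ≡ a
  liesOver-self {x = x} over = trans (sym (φₙᵐ-refl ≤-refl x)) (over ≤-refl)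

  SeparatedAbove : ∀ n → Carrier (A P n) → Carrier (A P n) → Set
  SeparatedAbove n a b =
    ∃[ m ] Σ (n < m) λ n<m →
      ∀ (a′ b′ : Carrier (A P m)) →
        φₙᵐ P n m (<⇒≤ n<m) a′ ≡ a →
        φₙᵐ P n m (<⇒≤ n<m) b′ ≡ b →
        DistGe (R (A P m)) a′ b′ 3

module _ (em : ExcludedMiddle 0ℓ) {L : Language} (P : ProjSeq L) where

  private
    dne : DoubleNegationElimination 0ℓ
    dne = em⇒dne em

    Rₖ : ∀ k → Carrier (A P k) → Carrier (A P k) → Set
    Rₖ k = R (A P k)

  neighbouringThread : (V : Thread P) {n : ℕ} (a : Carrier (A P n)) →
                       (∀ k → ∃ λ x → LiesOver P a k x × Rₖ k x (proj₁ V k)) →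
                       Σ (Thread P) λ U → R𝔸 P U V × proj₁ U n ≡ a
  neighbouringThread (v , v-thread) {n} a neighbours =
    let u , u-thread , inS = König.könig em (bond P) S S-closed (λ j → j , ≤-refl , neighbours j)
    in (u , u-thread) , proj₂ ∘ inS , liesOver-self P (proj₁ (inS n))
    where
    S : ∀ k → Carrier (A P k) → Set
    S k x = LiesOver P a k x × Rₖ k x (v k)

    S-closed : ∀ k y → S (suc k) y → S k (bond P k y)
    S-closed k y (over , r) =
      liesOver-bond P over , subst (Rₖ k (bond P k y)) (sym (v-thread k)) (R-bond P k r)

  module _ (R-refl : ∀ n → Reflexive′ (R (A P n))) (R-sym : ∀ n → Symmetric′ (R (A P n))) where

    separated⇒fine : (∀ n a b → DistEq (Rₖ n) a b 2 → SeparatedAbove P n a b) → Fine P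
    separated⇒fine separated = record
      { refl  = λ {u} n → R-refl n (proj₁ u n)
      ; sym   = λ uv n → R-sym n (uv n)
      ; trans = λ {u} {v} {w} → transitive u v w
      }
      where
      transitive : ∀ u v w → R𝔸 P u v → R𝔸 P v w → R𝔸 P u w
      transitive u v w uv vw n = dne λ ¬uw →
        let m , n<m , apart = separated n (proj₁ u n) (proj₁ w n)
                                (cons (uv n) (cons (vw n) nil) , ¬adjacent⇒DistGe2 (R-refl n) ¬uw)
        in 1+n≰n (apart (proj₁ u m) (proj₁ w m) (φₙᵐ-thread P u (<⇒≤ n<m)) (φₙᵐ-thread P w (<⇒≤ n<m))
                        2 (cons (uv m) (cons (vw m) nil)))

    module _ (fine : Fine P) {n} {a b : Carrier (A P n)} (¬separated : ¬ SeparatedAbove P n a b) where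

      LiftedMidpoint : ∀ k → Carrier (A P k) → Set
      LiftedMidpoint k c =
        ∃ λ a′ → ∃ λ b′ → LiesOver P a k a′ × LiesOver P b k b′ × Rₖ k a′ c × Rₖ k c b′

      liftedMidpoint-bond : ∀ k c → LiftedMidpoint (suc k) c → LiftedMidpoint k (bond P k c)
      liftedMidpoint-bond k c (a′ , b′ , over-a , over-b , r₁ , r₂) =
        bond P k a′ , bond P k b′ , liesOver-bond P over-a , liesOver-bond P over-b ,
        R-bond P k r₁ , R-bond P k r₂

      liftedMidpoint-above : ∀ k → n < k → ∃ (LiftedMidpoint k)
      liftedMidpoint-above k n<k = dne λ ¬midpoint → ¬separated (k , n<k , λ a′ b′ φa′≡a φb′≡b →
        ¬commonNeighbour⇒DistGe3 (R-refl k) λ (c , r₁ , r₂) →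
          ¬midpoint (c , a′ , b′ , liesOver-intro P (<⇒≤ n<k) φa′≡a ,
                   liesOver-intro P (<⇒≤ n<k) φb′≡b , r₁ , r₂))

      midpointThread : Σ (Thread P) λ V → ∀ k → LiftedMidpoint k (proj₁ V k)
      midpointThread =
        let v , v-thread , midpoint = König.könig em (bond P) LiftedMidpoint liftedMidpoint-bond cofinal
        in (v , v-thread) , midpoint
        where
        cofinal : ∀ j → ∃ λ m → j ≤ m × ∃ (LiftedMidpoint m)
        cofinal j = suc (n + j) , m≤n⇒m≤1+n (m≤n+m j n) , liftedMidpoint-above _ (s≤s (m≤m+n n j))

      adjacent : Rₖ n a b
      adjacent =
        let V , midpoint = midpointThread
            U , UV , Uₙ≡a = neighbouringThread V a λ k →
              let a′ , _ , over-a , _ , r₁ , _ = midpoint k in a′ , over-a , r₁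
            W , WV , Wₙ≡b = neighbouringThread V b λ k →
              let _ , b′ , _ , over-b , _ , r₂ = midpoint k in b′ , over-b , R-sym k r₂
            UW = IsEquivalence.trans fine {U} {V} {W} UV (IsEquivalence.sym fine {W} {V} WV)
        in subst₂ (Rₖ n) Uₙ≡a Wₙ≡b (UW n)

    fine⇒separated : Fine P → ∀ n a b → DistEq (Rₖ n) a b 2 → SeparatedAbove P n a b
    fine⇒separated fine n a b (_ , minimal) =
      dne λ ¬separated → 1+n≰n (minimal 1 (cons (adjacent fine ¬separated) nil))

lemma2p5 : ExcludedMiddle 0ℓ →
    {L : Language} (P : ProjSeq L) →
    (∀ n → Reflexive′ (R (A P n))) →
    (∀ n → Symmetric′ (R (A P n))) →
    Fine P ⟺
      (∀ (n : ℕ) (a b : Carrier (A P n)) →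
        DistEq (R (A P n)) a b 2 →
        ∃[ m ] Σ (n < m) λ n<m →
          ∀ (a′ b′ : Carrier (A P m)) →
            φₙᵐ P n m (<⇒≤ n<m) a′ ≡ a →
            φₙᵐ P n m (<⇒≤ n<m) b′ ≡ b →
            DistGe (R (A P m)) a′ b′ 3)
lemma2p5 em P R-refl R-sym = fine⇒separated em P R-refl R-sym , separated⇒fine em P R-refl R-sym
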